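{- For every integer $n \geq 3$, the number of permutations $\pi$ of $\{1,2,\dots,n\}$ which contain exactly one occurrence of the pattern $123$ and no occurrence of the pattern $132$ equals $(n-2)2^{n-3}$.
   Context: A permutation $\pi$ of $\{1,\dots,n\}$ is written as the sequence $\pi(1)\pi(2)\cdots\pi(n)$. An occurrence of the pattern $123$ in $\pi$ is a triple of indices $i<j<k$ with $\pi(i)<\pi(j)<\pi(k)$. An occurrence of the pattern $132$ in $\pi$ is a triple of indices $i<j<k$ with $\pi(i)<\pi(k)<\pi(j)$. A permutation avoids a pattern if it has no occurrence of it. -}

module Defs where

open import Data.Nat using (ℕ)
open import Data.Empty using (⊥)
open import Data.Fin using (Fin; _<_)
open import Data.Vec using (Vec; lookup)
open import Data.Product using (Σ; _×_; ∃)
open import Data.List using (List; length)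
open import Data.List.Membership.Propositional using (_∈_)
open import Data.List.Relation.Unary.Unique.Propositional using (Unique)
open import Relation.Binary.PropositionalEquality using (_≡_)
open import Function.Definitions using (Injective)

-- A permutation of {1..n} (shifted to {0..n-1}), written as the sequence
-- π(1)π(2)…π(n): a vector whose entries are pairwise distinct.
IsPerm : {n : ℕ} → Vec (Fin n) n → Set
IsPerm π = Injective _≡_ _≡_ (lookup π)

record Triple (n : ℕ) : Set where
  constructor triple
  field
    i j k : Fin n

Occ123 : {n : ℕ} → Vec (Fin n) n → Triple n → Set
Occ123 π (triple i j k) =
  (i < j) × (j < k) × (lookup π i < lookup π j) × (lookup π j < lookup π k)

Occ132 : {n : ℕ} → Vec (Fin n) n → Triple n → Set
Occ132 π (triple i j k) =
  (i < j) × (j < k) × (lookup π i < lookup π k) × (lookup π k < lookup π j)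

ExactlyOne : {n : ℕ} → (Triple n → Set) → Set
ExactlyOne {n} Occ = Σ (Triple n) λ t → Occ t × (∀ t′ → Occ t′ → t′ ≡ t)

Avoids : {n : ℕ} → (Triple n → Set) → Set
Avoids {n} Occ = ∀ (t : Triple n) → Occ t → ⊥

Good : {n : ℕ} → Vec (Fin n) n → Set
Good π = IsPerm π × ExactlyOne (Occ123 π) × Avoids (Occ132 π)

-- "The number of x : Vec (Fin n) n satisfying P is m": there is a duplicate-free
-- list enumerating exactly the vectors satisfying P, and it has length m.
CountIs : {n : ℕ} → (Vec (Fin n) n → Set) → ℕ → Set
CountIs {n} P m = Σ (List (Vec (Fin n) n)) λ xs →
  Unique xs × (∀ π → π ∈ xs → P π) × (∀ π → P π → π ∈ xs) × (length xs ≡ m)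

-- Write π as its first entry x followed by the standardised rest g. Avoiding 132 forces the
-- entries larger than x to occur in increasing order, so any two of them form a 123 with x.
-- Hence the number of entries above x decides everything: with at most one, π is good
-- (resp. avoids 123 and 132) iff g is; with exactly two, π is good iff g avoids both
-- patterns and its two largest values occur in increasing order, which for such g means
-- that g starts with its second largest value; with three or more, π has two 123's.
-- So Av(123, 132) has 2^n elements of length n + 1, and the good permutations of length
-- n + 2 number a(n) with a(0) = 0 and a(n + 1) = 2 a(n) + 2^n, i.e. a(n) = n 2^(n-1).

module Submission where

open import Defs
open import Data.Nat as ℕ using (ℕ; zero; suc; _+_; _∸_; _*_; _^_; _≥_; z≤n; s≤s; z<s; s<s)
import Data.Nat.Properties as ℕ
open import Data.Nat.Solver using (module +-*-Solver)
open import Data.Fin using (Fin; zero; suc; toℕ; fromℕ<; punchIn; punchOut; _<_; _≤_)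
open import Data.Fin.Properties
  using (_≟_; any?; pigeonhole; suc-injective; toℕ-injective; toℕ<n; toℕ-fromℕ<; <-cmp; <-irrefl; <-asym; <⇒≢; ≤∧≢⇒<;
         punchIn-injective; punchInᵢ≢i; punchIn-mono-≤; punchIn-cancel-≤; punchIn-punchOut; punchOut-injective)
open import Data.Vec as Vec using (Vec; lookup; tabulate)
open import Data.Vec.Properties using (lookup-map; ∷-injective; tabulate-∘; tabulate-cong; tabulate∘lookup)
open import Data.List as List using ([]; _∷_; _++_)
open import Data.List.Properties using (length-map; length-++)
open import Data.List.Membership.Propositional using (_∈_)
open import Data.List.Membership.Propositional.Properties using (∈-map⁺; ∈-map⁻; ∈-++⁺ˡ; ∈-++⁺ʳ; ∈-++⁻)
open import Data.List.Relation.Unary.Any using (here)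
open import Data.List.Relation.Unary.All using ([])
open import Data.List.Relation.Unary.AllPairs using ([]; _∷_)
import Data.List.Relation.Unary.Unique.Propositional.Properties as Unique
open import Data.Product using (_×_; ∃; ∃₂; _,_; proj₁; proj₂)
open import Data.Product.Function.NonDependent.Propositional using (_×-⇔_)
open import Data.Sum as Sum using (_⊎_; inj₁; inj₂)
open import Data.Empty using (⊥; ⊥-elim)
open import Function using (_∘_; _⇔_; mk⇔; Equivalence)
open import Function.Definitions using (Injective)
open import Relation.Nullary using (¬_; yes; no; contradiction)
open import Relation.Binary.PropositionalEquality
  using (_≡_; _≢_; _≗_; refl; sym; trans; cong; cong₂; subst; subst₂; module ≡-Reasoning)
open import Relation.Binary.Definitions using (tri<; tri≈; tri>)

open Equivalence using (to; from)

private variable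
  m n N : ℕ

injective⇒surjective : {f : Fin n → Fin n} → Injective _≡_ _≡_ f → ∀ v → ∃ λ i → f i ≡ v
injective⇒surjective {suc n} {f} inj v with any? (λ i → f i ≟ v)
... | yes hit  = hit
... | no  miss =
  let i , j , i<j , eq = pigeonhole (ℕ.n<1+n n) (λ i → punchOut (v≢f i))
  in contradiction (inj (punchOut-injective (v≢f i) (v≢f j) eq)) (<⇒≢ i<j)
  where
  v≢f : ∀ i → v ≢ f i
  v≢f i e = miss (i , sym e)

position : {f : Fin n → Fin n} → Injective _≡_ _≡_ f → ∀ {a} → a ℕ.< n → ∃ λ p → toℕ (f p) ≡ a
position inj a<n =
  let p , fp≡a = injective⇒surjective inj (fromℕ< a<n)
  in p , trans (cong toℕ fp≡a) (toℕ-fromℕ< a<n)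

consecutive⇒< : {u : Fin m} {v : Fin n} {a : ℕ} → toℕ u ≡ a → toℕ v ≡ suc a → u < v
consecutive⇒< u≡a v≡1+a = ℕ.≤-reflexive (trans (cong suc u≡a) (sym v≡1+a))

punchIn-mono-< : ∀ (x : Fin (suc n)) {u v} → u < v → punchIn x u < punchIn x v
punchIn-mono-< x {u} {v} u<v =
  ≤∧≢⇒< (punchIn-mono-≤ x u v (ℕ.<⇒≤ u<v)) (<⇒≢ u<v ∘ punchIn-injective x u v)

punchIn-cancel-< : ∀ (x : Fin (suc n)) {u v} → punchIn x u < punchIn x v → u < v
punchIn-cancel-< x {u} {v} lt = ≤∧≢⇒< (punchIn-cancel-≤ x u v (ℕ.<⇒≤ lt)) (<⇒≢ lt ∘ cong (punchIn x))

≤⇒<punchIn : ∀ (x : Fin (suc n)) {v} → x ≤ v → x < punchIn x v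
≤⇒<punchIn zero    {v}     _         = z<s
≤⇒<punchIn (suc x) {suc v} (s≤s x≤v) = s<s (≤⇒<punchIn x x≤v)

<punchIn⇒≤ : ∀ (x : Fin (suc n)) {v} → x < punchIn x v → x ≤ v
<punchIn⇒≤ zero    {v}     _         = z≤n
<punchIn⇒≤ (suc x) {suc v} (s<s x<v) = s≤s (<punchIn⇒≤ x x<v)

Shape : Set₁
Shape = ∀ {m} → Fin m → Fin m → Fin m → Set

Shape123 Shape132 : Shape
Shape123 a b c = a < b × b < c
Shape132 a b c = a < c × c < b

Occurs : Shape → (Fin n → Fin n) → Triple n → Set
Occurs P f (triple i j k) = i < j × j < k × P (f i) (f j) (f k)

-- Good π unfolds to GoodFn (lookup π): Occ123 π and Occ132 π are Occurs Shape123/Shape132 (lookup π).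
GoodFn AvoidsBoth : (Fin n → Fin n) → Set
GoodFn     f = Injective _≡_ _≡_ f × ExactlyOne (Occurs Shape123 f) × Avoids (Occurs Shape132 f)
AvoidsBoth f = Injective _≡_ _≡_ f × Avoids (Occurs Shape123 f) × Avoids (Occurs Shape132 f)

record RisesAt (a : ℕ) (f : Fin n → Fin n) : Set where
  constructor rise
  field
    low high   : Fin n
    low<high   : low < high
    low-value  : toℕ (f low) ≡ a
    high-value : toℕ (f high) ≡ suc a

open RisesAt

exactlyOne-≡ : {O : Triple n → Set} → ExactlyOne O → ∀ {t t′} → O t → O t′ → t ≡ t′
exactlyOne-≡ (_ , _ , unique) o o′ = trans (unique _ o) (sym (unique _ o′))

increasing-triple⇒3≤ : {i j k : Fin n} → i < j → j < k → 3 ℕ.≤ n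
increasing-triple⇒3≤ {k = k} i<j j<k =
  ℕ.≤-trans (s≤s (s≤s (s≤s z≤n))) (ℕ.≤-trans (s≤s (s≤s i<j)) (ℕ.≤-trans (s≤s j<k) (toℕ<n k)))

avoids-short : ∀ (P : Shape) {f : Fin n → Fin n} → n ℕ.< 3 → Avoids (Occurs P f)
avoids-short P n<3 (triple i j k) (i<j , j<k , _) = ℕ.<⇒≱ n<3 (increasing-triple⇒3≤ i<j j<k)

module _ {f h : Fin n → Fin n} (f≗h : f ≗ h) where

  injective-resp : Injective _≡_ _≡_ f → Injective _≡_ _≡_ h
  injective-resp inj {i} {j} e = inj (trans (f≗h i) (trans e (sym (f≗h j))))

  occurs-resp : ∀ (P : Shape) t → Occurs P f t → Occurs P h t
  occurs-resp P (triple i j k) o rewrite sym (f≗h i) | sym (f≗h j) | sym (f≗h k) = o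

  occurs-resp⁻ : ∀ (P : Shape) t → Occurs P h t → Occurs P f t
  occurs-resp⁻ P (triple i j k) o rewrite f≗h i | f≗h j | f≗h k = o

  avoids-resp : ∀ (P : Shape) → Avoids (Occurs P f) → Avoids (Occurs P h)
  avoids-resp P av t = av t ∘ occurs-resp⁻ P t

  exactlyOne-resp : ∀ (P : Shape) → ExactlyOne (Occurs P f) → ExactlyOne (Occurs P h)
  exactlyOne-resp P (t , o , unique) = t , occurs-resp P t o , λ t′ → unique t′ ∘ occurs-resp⁻ P t′

  goodFn-resp : GoodFn f → GoodFn h
  goodFn-resp (inj , one , av) =
    injective-resp inj , exactlyOne-resp Shape123 one , avoids-resp Shape132 av

  avoidsBoth-resp : AvoidsBoth f → AvoidsBoth h
  avoidsBoth-resp (inj , av , av′) =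
    injective-resp inj , avoids-resp Shape123 av , avoids-resp Shape132 av′

  risesAt-resp : ∀ {a} → RisesAt a f → RisesAt a h
  risesAt-resp (rise j k j<k fj≡a fk≡1+a) =
    rise j k j<k (trans (cong toℕ (sym (f≗h j))) fj≡a) (trans (cong toℕ (sym (f≗h k))) fk≡1+a)

PunchInStable : Shape → Set
PunchInStable P =
  ∀ {m} (x : Fin (suc m)) {a b c : Fin m} → P a b c ⇔ P (punchIn x a) (punchIn x b) (punchIn x c)

punchIn-<⇔ : ∀ (x : Fin (suc n)) {u v} → u < v ⇔ punchIn x u < punchIn x v
punchIn-<⇔ x = mk⇔ (punchIn-mono-< x) (punchIn-cancel-< x)

shape123-stable : PunchInStable Shape123
shape123-stable x = punchIn-<⇔ x ×-⇔ punchIn-<⇔ x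

shape132-stable : PunchInStable Shape132
shape132-stable x = punchIn-<⇔ x ×-⇔ punchIn-<⇔ x

prepend : Fin (suc n) → (Fin n → Fin n) → Fin (suc n) → Fin (suc n)
prepend x g zero    = x
prepend x g (suc i) = punchIn x (g i)

liftTriple : Triple n → Triple (suc n)
liftTriple (triple i j k) = triple (suc i) (suc j) (suc k)

liftTriple-injective : {t t′ : Triple n} → liftTriple t ≡ liftTriple t′ → t ≡ t′
liftTriple-injective {t = triple _ _ _} {triple _ _ _} refl = refl

data TripleView {n} : Triple (suc n) → Set where
  atHead : (j k : Fin n) → TripleView (triple zero (suc j) (suc k))
  lifted : (t : Triple n) → TripleView (liftTriple t)

tripleView : ∀ (t : Triple (suc n)) → Triple.i t < Triple.j t → Triple.j t < Triple.k t → TripleView t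
tripleView (triple zero    (suc j) (suc k)) _  _  = atHead j k
tripleView (triple (suc i) (suc j) (suc k)) _  _  = lifted (triple i j k)
tripleView (triple _       zero    _)       () _
tripleView (triple _       (suc _) zero)    _  ()

-- Exactly d elements of Fin (suc N) exceed x.
Above : ℕ → Fin (suc N) → Set
Above {N} d x = N ≡ d + toℕ x

AtMostOneAbove : Fin (suc N) → Set
AtMostOneAbove x = Above 0 x ⊎ Above 1 x

gap-cases : ∀ {k m} → k ℕ.≤ m → (m ≡ k ⊎ m ≡ 1 + k) ⊎ m ≡ 2 + k ⊎ 3 + k ℕ.≤ m
gap-cases {m = 0}                 z≤n = inj₁ (inj₁ refl)
gap-cases {m = 1}                 z≤n = inj₁ (inj₂ refl)
gap-cases {m = 2}                 z≤n = inj₂ (inj₁ refl)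
gap-cases {m = suc (suc (suc _))} z≤n = inj₂ (inj₂ (s≤s (s≤s (s≤s z≤n))))
gap-cases (s≤s k≤m) = Sum.map (Sum.map (cong suc) (cong suc)) (Sum.map (cong suc) s≤s) (gap-cases k≤m)

above-cases : (x : Fin (suc N)) → AtMostOneAbove x ⊎ Above 2 x ⊎ 3 + toℕ x ℕ.≤ N
above-cases x = gap-cases (ℕ.≤-pred (toℕ<n x))

module Prepend {N} (x : Fin (suc N)) (g : Fin N → Fin N) where

  injective-prepend⇔ : Injective _≡_ _≡_ g ⇔ Injective _≡_ _≡_ (prepend x g)
  injective-prepend⇔ = mk⇔ prepend-injective tail-injective
    where
    prepend-injective : Injective _≡_ _≡_ g → Injective _≡_ _≡_ (prepend x g)
    prepend-injective inj {zero}  {zero}  _ = refl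
    prepend-injective inj {zero}  {suc j} e = contradiction (sym e) (punchInᵢ≢i x (g j))
    prepend-injective inj {suc i} {zero}  e = contradiction e (punchInᵢ≢i x (g i))
    prepend-injective inj {suc i} {suc j} e = cong suc (inj (punchIn-injective x (g i) (g j) e))

    tail-injective : Injective _≡_ _≡_ (prepend x g) → Injective _≡_ _≡_ g
    tail-injective inj {i} {j} e = suc-injective (inj {suc i} {suc j} (cong (punchIn x) e))

  HeadFree : Shape → Set
  HeadFree P = ∀ j k → ¬ Occurs P (prepend x g) (triple zero (suc j) (suc k))

  module _ (P : Shape) (stable : PunchInStable P) where

    occurs-lift⇔ : ∀ t → Occurs P g t ⇔ Occurs P (prepend x g) (liftTriple t)
    occurs-lift⇔ (triple i j k) = mk⇔
      (λ (i<j , j<k , p) → s<s i<j , s<s j<k , to (stable x) p)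
      (λ (i<j , j<k , p) → ℕ.s<s⁻¹ i<j , ℕ.s<s⁻¹ j<k , from (stable x) p)

    avoids-tail : Avoids (Occurs P (prepend x g)) → Avoids (Occurs P g)
    avoids-tail av t = av (liftTriple t) ∘ to (occurs-lift⇔ t)

    unlift : HeadFree P → ∀ t → Occurs P (prepend x g) t → ∃ λ t′ → t ≡ liftTriple t′ × Occurs P g t′
    unlift free t o with tripleView t (proj₁ o) (proj₁ (proj₂ o))
    ... | atHead j k = ⊥-elim (free j k o)
    ... | lifted t′  = t′ , refl , from (occurs-lift⇔ t′) o

    avoids-prepend⇔ : HeadFree P → Avoids (Occurs P g) ⇔ Avoids (Occurs P (prepend x g))
    avoids-prepend⇔ free = mk⇔ (λ av t o → let t′ , _ , o′ = unlift free t o in av t′ o′) avoids-tail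

    exactlyOne-prepend⇔ : HeadFree P → ExactlyOne (Occurs P g) ⇔ ExactlyOne (Occurs P (prepend x g))
    exactlyOne-prepend⇔ free = mk⇔ lift-one unlift-one
      where
      lift-one : ExactlyOne (Occurs P g) → ExactlyOne (Occurs P (prepend x g))
      lift-one (t , o , unique) = liftTriple t , to (occurs-lift⇔ t) o , λ t′ o′ →
        let t″ , t′≡ , o″ = unlift free t′ o′ in trans t′≡ (cong liftTriple (unique t″ o″))

      unlift-one : ExactlyOne (Occurs P (prepend x g)) → ExactlyOne (Occurs P g)
      unlift-one (t , o , unique) =
        let t′ , t≡ , o′ = unlift free t o
        in t′ , o′ , λ t″ o″ → liftTriple-injective (trans (unique _ (to (occurs-lift⇔ t″) o″)) t≡)

  module _ (top : AtMostOneAbove x) where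

    no-two-above : {u v : Fin (suc N)} → x < u → u < v → ⊥
    no-two-above {u} {v} x<u u<v = ℕ.<-irrefl refl (begin-strict
      toℕ v         ≤⟨ ℕ.≤-pred (toℕ<n v) ⟩
      N             ≤⟨ N≤1+x top ⟩
      suc (toℕ x)   ≤⟨ x<u ⟩
      toℕ u         <⟨ u<v ⟩
      toℕ v         ∎)
      where
      open ℕ.≤-Reasoning
      N≤1+x : AtMostOneAbove x → N ℕ.≤ suc (toℕ x)
      N≤1+x (inj₁ above) = ℕ.≤-trans (ℕ.≤-reflexive above) (ℕ.n≤1+n _)
      N≤1+x (inj₂ above) = ℕ.≤-reflexive above

    headFree123 : HeadFree Shape123
    headFree123 _ _ (_ , _ , x<u , u<v) = no-two-above x<u u<v

    headFree132 : HeadFree Shape132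
    headFree132 _ _ (_ , _ , x<u , u<v) = no-two-above x<u u<v

    good-prepend-top⇔ : GoodFn g ⇔ GoodFn (prepend x g)
    good-prepend-top⇔ =
      injective-prepend⇔ ×-⇔ exactlyOne-prepend⇔ Shape123 shape123-stable headFree123
                         ×-⇔ avoids-prepend⇔ Shape132 shape132-stable headFree132

    avoidsBoth-prepend-top⇔ : AvoidsBoth g ⇔ AvoidsBoth (prepend x g)
    avoidsBoth-prepend-top⇔ =
      injective-prepend⇔ ×-⇔ avoids-prepend⇔ Shape123 shape123-stable headFree123
                         ×-⇔ avoids-prepend⇔ Shape132 shape132-stable headFree132

  increasing-after-head : Avoids (Occurs Shape132 (prepend x g)) → ∀ {p q} → x ≤ g p → g p < g q → p < q
  increasing-after-head av {p} {q} x≤gp gp<gq with <-cmp p q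
  ... | tri< p<q _ _ = p<q
  ... | tri≈ _ refl _ = contradiction gp<gq (<-irrefl refl)
  ... | tri> _ _ q<p = contradiction (z<s , s<s q<p , ≤⇒<punchIn x x≤gp , punchIn-mono-< x gp<gq) (av _)

  rise-after-head : Injective _≡_ _≡_ g → Avoids (Occurs Shape132 (prepend x g)) →
                    ∀ {a} → toℕ x ℕ.≤ a → 2 + a ℕ.≤ N → RisesAt a g
  rise-after-head inj av x≤a 2+a≤N =
    let p , gp≡a   = position inj (ℕ.≤-trans (ℕ.n≤1+n _) 2+a≤N)
        q , gq≡1+a = position inj 2+a≤N
        x≤gp       = ℕ.≤-trans x≤a (ℕ.≤-reflexive (sym gp≡a))
    in rise p q (increasing-after-head av x≤gp (consecutive⇒< gp≡a gq≡1+a)) gp≡a gq≡1+a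

  riseTriple : ∀ {a} → RisesAt a g → Triple (suc N)
  riseTriple r = triple zero (suc (low r)) (suc (high r))

  occurs123-riseTriple : ∀ {a} → toℕ x ℕ.≤ a → (r : RisesAt a g) →
                         Occurs Shape123 (prepend x g) (riseTriple r)
  occurs123-riseTriple x≤a (rise j k j<k gj≡a gk≡1+a) =
    z<s , s<s j<k , ≤⇒<punchIn x (ℕ.≤-trans x≤a (ℕ.≤-reflexive (sym gj≡a))) ,
    punchIn-mono-< x (consecutive⇒< gj≡a gk≡1+a)

  ¬avoidsBoth-prepend : 2 + toℕ x ℕ.≤ N → ¬ AvoidsBoth (prepend x g)
  ¬avoidsBoth-prepend 2+x≤N (inj , av123 , av132) =
    let r = rise-after-head (from injective-prepend⇔ inj) av132 ℕ.≤-refl 2+x≤N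
    in av123 (riseTriple r) (occurs123-riseTriple ℕ.≤-refl r)

  -- The rises at x and at x + 1 are two 123 occurrences through the head with different middles.
  ¬good-prepend : 3 + toℕ x ℕ.≤ N → ¬ GoodFn (prepend x g)
  ¬good-prepend 3+x≤N (inj , one , av132) = ℕ.1+n≢n (sym (begin
    toℕ x            ≡⟨ sym (low-value r₀) ⟩
    toℕ (g (low r₀)) ≡⟨ cong (toℕ ∘ g) same-low ⟩
    toℕ (g (low r₁)) ≡⟨ low-value r₁ ⟩
    suc (toℕ x)      ∎))
    where
    open ≡-Reasoning
    injg = from injective-prepend⇔ inj
    r₀ : RisesAt (toℕ x) g
    r₀ = rise-after-head injg av132 ℕ.≤-refl (ℕ.≤-trans (ℕ.n≤1+n _) 3+x≤N)
    r₁ : RisesAt (suc (toℕ x)) g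
    r₁ = rise-after-head injg av132 (ℕ.n≤1+n _) 3+x≤N
    same-low : low r₀ ≡ low r₁
    same-low = suc-injective (cong Triple.j (exactlyOne-≡ one (occurs123-riseTriple ℕ.≤-refl r₀)
                                                              (occurs123-riseTriple (ℕ.n≤1+n _) r₁)))

  module _ (above : Above 2 x) where

    pinned-values : {u v : Fin N} → x ≤ u → u < v → toℕ u ≡ toℕ x × toℕ v ≡ suc (toℕ x)
    pinned-values {u} {v} x≤u u<v =
      ℕ.≤-antisym (ℕ.s≤s⁻¹ (ℕ.≤-trans u<v v≤1+x)) x≤u , ℕ.≤-antisym v≤1+x (ℕ.≤-trans (s≤s x≤u) u<v)
      where
      v≤1+x : toℕ v ℕ.≤ suc (toℕ x)
      v≤1+x = ℕ.s≤s⁻¹ (subst (toℕ v ℕ.<_) above (toℕ<n v))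

    pinned-positions : Injective _≡_ _≡_ g → (r : RisesAt (toℕ x) g) → ∀ {i j} →
                       x < punchIn x (g i) → punchIn x (g i) < punchIn x (g j) → i ≡ low r × j ≡ high r
    pinned-positions inj r x<gi gi<gj =
      let gi≡x , gj≡1+x = pinned-values (<punchIn⇒≤ x x<gi) (punchIn-cancel-< x gi<gj)
      in inj (toℕ-injective (trans gi≡x (sym (low-value r)))) ,
         inj (toℕ-injective (trans gj≡1+x (sym (high-value r))))

    good-prepend-twoAbove⇔ : GoodFn (prepend x g) ⇔ (AvoidsBoth g × RisesAt (toℕ x) g)
    good-prepend-twoAbove⇔ = mk⇔ forward backward
      where
      forward : GoodFn (prepend x g) → AvoidsBoth g × RisesAt (toℕ x) g
      forward (inj , one , av132) = (injg , av123 , avoids-tail Shape132 shape132-stable av132) , r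
        where
        injg = from injective-prepend⇔ inj
        r = rise-after-head injg av132 ℕ.≤-refl (ℕ.≤-reflexive (sym above))
        av123 : Avoids (Occurs Shape123 g)
        av123 t o = contradiction (cong Triple.i (exactlyOne-≡ one (to (occurs-lift⇔ Shape123 shape123-stable t) o)
                                                                   (occurs123-riseTriple ℕ.≤-refl r))) λ ()

      backward : AvoidsBoth g × RisesAt (toℕ x) g → GoodFn (prepend x g)
      backward ((injg , av123 , av132) , r) =
        to injective-prepend⇔ injg ,
        (riseTriple r , occurs123-riseTriple ℕ.≤-refl r , unique) ,
        to (avoids-prepend⇔ Shape132 shape132-stable no-head-132) av132
        where
        unique : ∀ t → Occurs Shape123 (prepend x g) t → t ≡ riseTriple r
        unique t o@(i<j , j<k , x<u , u<v) with tripleView t i<j j<k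
        ... | atHead _ _ = let i≡ , j≡ = pinned-positions injg r x<u u<v
                           in cong₂ (λ j k → triple zero (suc j) (suc k)) i≡ j≡
        ... | lifted t′  = ⊥-elim (av123 t′ (from (occurs-lift⇔ Shape123 shape123-stable t′) o))

        no-head-132 : HeadFree Shape132
        no-head-132 _ _ (_ , j<k , x<u , u<v) =
          let k≡ , j≡ = pinned-positions injg r x<u u<v
          in <-asym (low<high r) (subst₂ _<_ j≡ k≡ (ℕ.s<s⁻¹ j<k))

  good-prepend⇔ : GoodFn (prepend x g) ⇔
                  (AtMostOneAbove x × GoodFn g ⊎ Above 2 x × AvoidsBoth g × RisesAt (toℕ x) g)
  good-prepend⇔ = mk⇔ forward backward
    where
    forward : GoodFn (prepend x g) →
              AtMostOneAbove x × GoodFn g ⊎ Above 2 x × AvoidsBoth g × RisesAt (toℕ x) g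
    forward good with above-cases x
    ... | inj₁ top          = inj₁ (top , from (good-prepend-top⇔ top) good)
    ... | inj₂ (inj₁ above) = inj₂ (above , to (good-prepend-twoAbove⇔ above) good)
    ... | inj₂ (inj₂ 3+x≤N) = ⊥-elim (¬good-prepend 3+x≤N good)

    backward : AtMostOneAbove x × GoodFn g ⊎ Above 2 x × AvoidsBoth g × RisesAt (toℕ x) g →
               GoodFn (prepend x g)
    backward (inj₁ (top , good))   = to (good-prepend-top⇔ top) good
    backward (inj₂ (above , rest)) = from (good-prepend-twoAbove⇔ above) rest

  avoidsBoth-prepend⇔ : AvoidsBoth (prepend x g) ⇔ (AtMostOneAbove x × AvoidsBoth g)
  avoidsBoth-prepend⇔ = mk⇔ forward λ (top , av) → to (avoidsBoth-prepend-top⇔ top) av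
    where
    forward : AvoidsBoth (prepend x g) → AtMostOneAbove x × AvoidsBoth g
    forward av with above-cases x
    ... | inj₁ top          = top , from (avoidsBoth-prepend-top⇔ top) av
    ... | inj₂ (inj₁ above) = ⊥-elim (¬avoidsBoth-prepend (ℕ.≤-reflexive (sym above)) av)
    ... | inj₂ (inj₂ 3+x≤N) = ⊥-elim (¬avoidsBoth-prepend (ℕ.≤-trans (ℕ.n≤1+n _) 3+x≤N) av)

  risesAtTop-prepend⇔ : ∀ {c} → N ≡ suc c →
                        (AvoidsBoth (prepend x g) × RisesAt c (prepend x g)) ⇔ (Above 1 x × AvoidsBoth g)
  risesAtTop-prepend⇔ {c} N≡1+c = mk⇔ forward backward
    where
    head≡c : AvoidsBoth (prepend x g) → RisesAt c (prepend x g) → toℕ x ≡ c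
    head≡c _ (rise zero _ _ x≡c _) = x≡c
    head≡c _ (rise (suc _) zero () _ _)
    head≡c (inj , av123 , _) (rise (suc j) (suc k) j<k fj≡c fk≡1+c) with ℕ.<-cmp (toℕ x) c
    ... | tri< x<c _ _ = ⊥-elim (av123 (triple zero (suc j) (suc k))
                           (z<s , j<k , subst (toℕ x ℕ.<_) (sym fj≡c) x<c , consecutive⇒< fj≡c fk≡1+c))
    ... | tri≈ _ x≡c _ = x≡c
    ... | tri> _ _ c<x = contradiction (inj {zero} {suc k} (toℕ-injective (trans x≡1+c (sym fk≡1+c)))) λ ()
      where
      x≡1+c : toℕ x ≡ suc c
      x≡1+c = ℕ.≤-antisym (subst (toℕ x ℕ.≤_) N≡1+c (ℕ.s≤s⁻¹ (toℕ<n x))) c<x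

    forward : AvoidsBoth (prepend x g) × RisesAt c (prepend x g) → Above 1 x × AvoidsBoth g
    forward (av , r) =
      let above = trans N≡1+c (cong suc (sym (head≡c av r)))
      in above , from (avoidsBoth-prepend-top⇔ (inj₂ above)) av

    backward : Above 1 x × AvoidsBoth g → AvoidsBoth (prepend x g) × RisesAt c (prepend x g)
    backward (above , avg) =
      let k , fk≡1+c = position (proj₁ av) (s≤s (ℕ.≤-reflexive (sym N≡1+c)))
      in av , rise-from-head k fk≡1+c
      where
      av = to (avoidsBoth-prepend-top⇔ (inj₂ above)) avg
      x≡c : toℕ x ≡ c
      x≡c = ℕ.suc-injective (trans (sym above) N≡1+c)
      rise-from-head : ∀ k → toℕ (prepend x g k) ≡ suc c → RisesAt c (prepend x g)
      rise-from-head zero    x≡1+c  = contradiction (trans (sym x≡c) x≡1+c) (ℕ.1+n≢n ∘ sym)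
      rise-from-head (suc k) fk≡1+c = rise zero (suc k) z<s x≡c fk≡1+c

insertHead : Fin (suc n) → Vec (Fin n) n → Vec (Fin (suc n)) (suc n)
insertHead x ρ = x Vec.∷ Vec.map (punchIn x) ρ

lookup-insertHead : ∀ x (ρ : Vec (Fin n) n) → lookup (insertHead x ρ) ≗ prepend x (lookup ρ)
lookup-insertHead x ρ zero    = refl
lookup-insertHead x ρ (suc i) = lookup-map i (punchIn x) ρ

map-injective : {A B : Set} {f : A → B} → (∀ {a b} → f a ≡ f b → a ≡ b) →
                {xs ys : Vec A m} → Vec.map f xs ≡ Vec.map f ys → xs ≡ ys
map-injective f-inj {Vec.[]}     {Vec.[]}     _ = refl
map-injective f-inj {x Vec.∷ xs} {y Vec.∷ ys} e =
  let fx≡fy , fxs≡fys = ∷-injective e in cong₂ Vec._∷_ (f-inj fx≡fy) (map-injective f-inj fxs≡fys)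

insertHead-injective : ∀ {x y} {ρ σ : Vec (Fin n) n} → insertHead x ρ ≡ insertHead y σ → x ≡ y × ρ ≡ σ
insertHead-injective {x = x} e with refl , e′ ← ∷-injective e = refl , map-injective (punchIn-injective x _ _) e′

insertHead-surjective : (π : Vec (Fin (suc n)) (suc n)) → IsPerm π → ∃₂ λ x ρ → π ≡ insertHead x ρ
insertHead-surjective (x Vec.∷ σ) inj = x , tabulate (λ i → punchOut (x≢σ i)) , cong (x Vec.∷_) (sym (begin
  Vec.map (punchIn x) (tabulate (λ i → punchOut (x≢σ i))) ≡⟨ tabulate-∘ (punchIn x) _ ⟨
  tabulate (λ i → punchIn x (punchOut (x≢σ i)))           ≡⟨ tabulate-cong (λ i → punchIn-punchOut (x≢σ i)) ⟩
  tabulate (lookup σ)                                      ≡⟨ tabulate∘lookup σ ⟩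
  σ                                                        ∎))
  where
  open ≡-Reasoning
  x≢σ : ∀ i → x ≢ lookup σ i
  x≢σ i e = contradiction (inj {zero} {suc i} e) λ ()

module _ {P Q : Vec (Fin n) n → Set} where

  count-⇔ : ∀ {c} → CountIs P c → (∀ π → P π → Q π) → (∀ π → Q π → P π) → CountIs Q c
  count-⇔ (πs , unique , sound , complete , len) P⇒Q Q⇒P =
    πs , unique , (λ π → P⇒Q π ∘ sound π) , (λ π → complete π ∘ Q⇒P π) , len

  count-⊎ : ∀ {a b} → CountIs P a → CountIs Q b → (∀ π → P π → Q π → ⊥) → CountIs (λ π → P π ⊎ Q π) (a + b)
  count-⊎ (πs , unique , sound , complete , len) (πs′ , unique′ , sound′ , complete′ , len′) disjoint =
    πs ++ πs′ , Unique.++⁺ unique unique′ (λ (π∈ , π∈′) → disjoint _ (sound _ π∈) (sound′ _ π∈′)) ,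
    sound⊎ , complete⊎ , trans (length-++ πs) (cong₂ _+_ len len′)
    where
    sound⊎ : ∀ π → π ∈ πs ++ πs′ → P π ⊎ Q π
    sound⊎ π π∈ = Sum.map (sound π) (sound′ π) (∈-++⁻ πs π∈)

    complete⊎ : ∀ π → P π ⊎ Q π → π ∈ πs ++ πs′
    complete⊎ π (inj₁ p) = ∈-++⁺ˡ (complete π p)
    complete⊎ π (inj₂ q) = ∈-++⁺ʳ πs (complete′ π q)

count-⊥ : {P : Vec (Fin n) n → Set} → (∀ π → ¬ P π) → CountIs P 0
count-⊥ ¬P = [] , [] , (λ _ ()) , (λ π → ⊥-elim ∘ ¬P π) , refl

HeadedBy : ℕ → (Vec (Fin n) n → Set) → Vec (Fin (suc n)) (suc n) → Set
HeadedBy d Q π = ∃₂ λ x ρ → Above d x × π ≡ insertHead x ρ × Q ρ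

headedBy-disjoint : ∀ {d e} {Q R : Vec (Fin n) n → Set} → d ≢ e → ∀ π → HeadedBy d Q π → HeadedBy e R π → ⊥
headedBy-disjoint {d = d} {e} d≢e π (x , _ , above , refl , _) (_ , _ , above′ , π≡ , _)
  with refl , _ ← insertHead-injective π≡ = d≢e (ℕ.+-cancelʳ-≡ (toℕ x) d e (trans (sym above) above′))

count-headedBy : ∀ d {Q : Vec (Fin n) n → Set} {c} → d ℕ.≤ n → CountIs Q c → CountIs (HeadedBy d Q) c
count-headedBy {n} d {Q} d≤n (ρs , unique , sound , complete , len) =
  List.map (insertHead x) ρs , Unique.map⁺ (proj₂ ∘ insertHead-injective) unique ,
  sound′ , complete′ , trans (length-map (insertHead x) ρs) len
  where
  x : Fin (suc n)
  x = fromℕ< (s≤s (ℕ.m∸n≤m n d))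

  above : Above d x
  above = trans (sym (ℕ.m+[n∸m]≡n d≤n)) (cong (d +_) (sym (toℕ-fromℕ< _)))

  sound′ : ∀ π → π ∈ List.map (insertHead x) ρs → HeadedBy d Q π
  sound′ π π∈ = let ρ , ρ∈ , π≡ = ∈-map⁻ (insertHead x) π∈ in x , ρ , above , π≡ , sound ρ ρ∈

  complete′ : ∀ π → HeadedBy d Q π → π ∈ List.map (insertHead x) ρs
  complete′ π (y , ρ , above′ , refl , q)
    with refl ← toℕ-injective {i = y} {x} (ℕ.+-cancelˡ-≡ d _ _ (trans (sym above′) above)) =
    ∈-map⁺ (insertHead x) (complete ρ q)

module HeadDecomposition {P : (Fin (suc n) → Fin (suc n)) → Set}
  (P-resp : ∀ {f h} → f ≗ h → P f → P h) (P-injective : ∀ {f} → P f → Injective _≡_ _≡_ f) where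

  decompose : ∀ π → P (lookup π) → ∃₂ λ x ρ → π ≡ insertHead x ρ × P (prepend x (lookup ρ))
  decompose π p with insertHead-surjective π (P-injective p)
  ... | x , ρ , refl = x , ρ , refl , P-resp (lookup-insertHead x ρ) p

  compose : ∀ {x ρ} → P (prepend x (lookup ρ)) → P (lookup (insertHead x ρ))
  compose {x} {ρ} = P-resp (sym ∘ lookup-insertHead x ρ)

avoidsBoth-count : ∀ n → CountIs {suc n} (AvoidsBoth ∘ lookup) (2 ^ n)
avoidsBoth-count zero = (zero Vec.∷ Vec.[]) ∷ [] , [] ∷ [] , sound , complete , refl
  where
  sound : ∀ π → π ∈ (zero Vec.∷ Vec.[]) ∷ [] → AvoidsBoth (lookup π)
  sound _ (here refl) =
    (λ { {zero} {zero} _ → refl }) , avoids-short Shape123 (s≤s (s≤s z≤n)) , avoids-short Shape132 (s≤s (s≤s z≤n))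

  complete : ∀ π → AvoidsBoth (lookup π) → π ∈ (zero Vec.∷ Vec.[]) ∷ []
  complete (zero Vec.∷ Vec.[]) _ = here refl
avoidsBoth-count (suc n) =
  subst (CountIs _) (cong (2 ^ n +_) (sym (ℕ.+-identityʳ _)))
    (count-⇔ (count-⊎ (count-headedBy 0 z≤n (avoidsBoth-count n))
                      (count-headedBy 1 (s≤s z≤n) (avoidsBoth-count n))
                      (headedBy-disjoint λ ()))
             join split)
  where
  open HeadDecomposition {P = AvoidsBoth} avoidsBoth-resp proj₁

  ByHead : Vec (Fin (2 + n)) (2 + n) → Set
  ByHead π = HeadedBy 0 (AvoidsBoth ∘ lookup) π ⊎ HeadedBy 1 (AvoidsBoth ∘ lookup) π

  split : ∀ π → AvoidsBoth (lookup π) → ByHead π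
  split π av with decompose π av
  ... | x , ρ , refl , av′ with to (Prepend.avoidsBoth-prepend⇔ x (lookup ρ)) av′
  ...   | inj₁ above , avρ = inj₁ (x , ρ , above , refl , avρ)
  ...   | inj₂ above , avρ = inj₂ (x , ρ , above , refl , avρ)

  join : ∀ π → ByHead π → AvoidsBoth (lookup π)
  join _ (inj₁ (x , ρ , above , refl , avρ)) =
    compose (from (Prepend.avoidsBoth-prepend⇔ x (lookup ρ)) (inj₁ above , avρ))
  join _ (inj₂ (x , ρ , above , refl , avρ)) =
    compose (from (Prepend.avoidsBoth-prepend⇔ x (lookup ρ)) (inj₂ above , avρ))

RisingTop : (Fin (2 + n) → Fin (2 + n)) → Set
RisingTop {n} f = AvoidsBoth f × RisesAt n f

risingTop-count : ∀ n → CountIs {2 + n} (RisingTop ∘ lookup) (2 ^ n)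
risingTop-count n = count-⇔ (count-headedBy 1 (s≤s z≤n) (avoidsBoth-count n)) join split
  where
  open HeadDecomposition {P = RisingTop} (λ e (av , r) → avoidsBoth-resp e av , risesAt-resp e r) (proj₁ ∘ proj₁)

  split : ∀ π → RisingTop (lookup π) → HeadedBy 1 (AvoidsBoth ∘ lookup) π
  split π r with decompose π r
  ... | x , ρ , refl , r′ =
    let above , avρ = to (Prepend.risesAtTop-prepend⇔ x (lookup ρ) refl) r′ in x , ρ , above , refl , avρ

  join : ∀ π → HeadedBy 1 (AvoidsBoth ∘ lookup) π → RisingTop (lookup π)
  join _ (x , ρ , above , refl , avρ) =
    compose (from (Prepend.risesAtTop-prepend⇔ x (lookup ρ) refl) (above , avρ))

good-recurrence : ∀ n → n * 2 ^ (n ∸ 1) + (n * 2 ^ (n ∸ 1) + 2 ^ n) ≡ suc n * 2 ^ n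
good-recurrence zero    = refl
good-recurrence (suc n) =
  solve 2 (λ n p → (con 1 :+ n) :* p :+ ((con 1 :+ n) :* p :+ con 2 :* p) := (con 2 :+ n) :* (con 2 :* p))
        refl n (2 ^ n)
  where open +-*-Solver

good-count : ∀ n → CountIs {2 + n} (GoodFn ∘ lookup) (n * 2 ^ (n ∸ 1))
good-count zero    = count-⊥ λ π (_ , (t , o , _) , _) → avoids-short Shape123 {lookup π} ℕ.≤-refl t o
good-count (suc n) =
  subst (CountIs _) (good-recurrence n)
    (count-⇔ (count-⊎ (count-headedBy 0 z≤n (good-count n))
                      (count-⊎ (count-headedBy 1 (s≤s z≤n) (good-count n))
                               (count-headedBy 2 (s≤s (s≤s z≤n)) (risingTop-count n))
                               (headedBy-disjoint λ ()))
                      λ π h → Sum.[ headedBy-disjoint (λ ()) π h , headedBy-disjoint (λ ()) π h ])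
             join split)
  where
  open HeadDecomposition {P = GoodFn} goodFn-resp proj₁

  ByHead : Vec (Fin (3 + n)) (3 + n) → Set
  ByHead π = HeadedBy 0 (GoodFn ∘ lookup) π ⊎ HeadedBy 1 (GoodFn ∘ lookup) π ⊎ HeadedBy 2 (RisingTop ∘ lookup) π

  rises-at-n : ∀ {x : Fin (3 + n)} {g : Fin (2 + n) → Fin (2 + n)} → Above 2 x → RisesAt (toℕ x) g ⇔ RisesAt n g
  rises-at-n {g = g} above =
    let x≡n = ℕ.suc-injective (ℕ.suc-injective (sym above))
    in mk⇔ (subst (λ a → RisesAt a g) x≡n) (subst (λ a → RisesAt a g) (sym x≡n))

  split : ∀ π → GoodFn (lookup π) → ByHead π
  split π good with decompose π good
  ... | x , ρ , refl , good′ with to (Prepend.good-prepend⇔ x (lookup ρ)) good′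
  ...   | inj₁ (inj₁ above , goodρ)      = inj₁ (x , ρ , above , refl , goodρ)
  ...   | inj₁ (inj₂ above , goodρ)      = inj₂ (inj₁ (x , ρ , above , refl , goodρ))
  ...   | inj₂ (above , avρ , rises)     = inj₂ (inj₂ (x , ρ , above , refl , avρ , to (rises-at-n above) rises))

  join : ∀ π → ByHead π → GoodFn (lookup π)
  join _ (inj₁ (x , ρ , above , refl , goodρ)) =
    compose (from (Prepend.good-prepend⇔ x (lookup ρ)) (inj₁ (inj₁ above , goodρ)))
  join _ (inj₂ (inj₁ (x , ρ , above , refl , goodρ))) =
    compose (from (Prepend.good-prepend⇔ x (lookup ρ)) (inj₁ (inj₂ above , goodρ)))
  join _ (inj₂ (inj₂ (x , ρ , above , refl , avρ , rises))) =
    compose (from (Prepend.good-prepend⇔ x (lookup ρ)) (inj₂ (above , avρ , from (rises-at-n above) rises)))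

theorem1 : (n : ℕ) → n ≥ 3 → CountIs {n} Good ((n ∸ 2) * 2 ^ (n ∸ 3))
theorem1 (suc (suc (suc n))) (s≤s (s≤s (s≤s _))) = good-count (suc n)
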